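{- Let $\ell$ be a prime and $t$ an integer with $\gcd(\ell,2t)=1$, and let $k\ge1$. For $0\le n\le k$, the number of $u\in(\mathbb{Z}/\ell^k\mathbb{Z})^*$ with $\nu_{\ell,k}(D(t,u))=n$ and satisfying the indicated additional condition is: $\frac{\varphi(\ell^{k-2i})}{2}-\ell^{k-1}\chi_{\{0\}}(n)$ if $n=2i<k$ and $\left(\frac{D(t,u)/\ell^n}{\ell}\right)=1$; $\frac{\varphi(\ell^{k-2i})}{2}$ if $n=2i<k$ and $\left(\frac{D(t,u)/\ell^n}{\ell}\right)=-1$; $\varphi(\ell^{k-2i-1})$ if $n=2i+1<k$ (no additional condition); $1$ if $n=k$ (no additional condition). Here $\chi_{\{0\}}(n)$ equals $1$ if $n=0$ and $0$ otherwise, $\varphi$ is Euler's function and $\left(\frac{\cdot}{\ell}\right)$ is the Legendre symbol.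
   Context: For integers $t,u$, $D(t,u):=t^2-4u$; an element $u\in\mathbb{Z}/\ell^k\mathbb{Z}$ is identified with an integer representative. For an odd prime $\ell$, $\nu_{\ell,k}(D(t,u)):=\nu_\ell(D(t,u))$ (the $\ell$-adic valuation) if $\ell^k\nmid D(t,u)$, and $:=k$ if $\ell^k\mid D(t,u)$. -}

module Defs where

open import Data.Nat as ℕ using (ℕ; zero; suc; _^_; _≡ᵇ_)
open import Data.Nat.Properties using (m^n≢0)
open import Data.Nat.Divisibility using (_∣?_)
open import Data.Nat.Coprimality using (coprime?)
open import Data.Integer as ℤ using (ℤ; +_; ∣_∣; _/ℕ_; _%ℕ_)
open import Data.List using (filter; length; upTo)
open import Data.Bool.ListAction using (any)
open import Data.Bool using (if_then_else_)
open import Relation.Nullary using (does)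

D : ℤ → ℤ → ℤ
D t u = t ℤ.* t ℤ.- (+ 4) ℤ.* u

φ : ℕ → ℕ
φ n = length (filter (λ m → coprime? m n) (upTo n))

-- Truncated valuation ν_{ℓ,k}(a): the largest n ≤ k with ℓ^n ∣ a.
-- This is k if ℓ^k ∣ a, and ν_ℓ(a) = max{ n | ℓ^n ∣ a } otherwise.
νtrunc : ℕ → ℕ → ℤ → ℕ
νtrunc ℓ k a = go k
  where
  go : ℕ → ℕ
  go zero    = zero
  go (suc j) = if does ((ℓ ^ suc j) ∣? ∣ a ∣) then suc j else go j

-- a / ℓ^n (integer division; exact whenever ℓ^n ∣ a). Junk value 0 for ℓ = 0.
divPow : ℤ → ℕ → ℕ → ℤ
divPow a zero    n = + 0
divPow a (suc m) n = _/ℕ_ a (suc m ^ n) {{m^n≢0 (suc m) n}}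

-- Legendre symbol (a / ℓ): 0 if ℓ ∣ a, 1 if a is a nonzero square mod ℓ, -1 otherwise.
-- (Junk value 0 for ℓ = 0; only used for odd primes ℓ.)
legendre : ℤ → ℕ → ℤ
legendre a zero    = + 0
legendre a (suc m) =
  if r ≡ᵇ 0 then + 0
  else if any (λ x → ((x ℕ.* x) ℕ.% suc m) ≡ᵇ r) (upTo (suc m)) then + 1
  else ℤ.- (+ 1)
  where
  r : ℕ
  r = a %ℕ suc m

-- χ_{{0}}(n) for n = 2i: equals 1 iff i = 0 (iff n = 0)
if0 : ℕ → ℤ
if0 zero    = + 1
if0 (suc _) = + 0

module Submission where

-- Write ℓ = 2h + 1 and D = D(t, u) = t² − 4u. Since 4 is invertible modulo every
-- power of ℓ, for each integer a exactly ℓ^(k−j) of the u < ℓ^k satisfy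
-- ℓ^j ∣ a − 4u. With a = t² this counts the u with ℓ^j ∣ D, and hence, by
-- difference, those with ν_{ℓ,k}(D) = n. For the Legendre condition, ℓ^n ∣ D
-- together with D/ℓ^n ≡ r (mod ℓ) says exactly that ℓ^(n+1) ∣ (t² − ℓ^n r) − 4u,
-- so every residue r < ℓ is attained ℓ^(k−n−1) times, and the count is ℓ^(k−n−1)
-- times the number h of quadratic residues (or non-residues) modulo ℓ.
-- Restricting to units changes little: for ℓ ∣ u we have D ≡ t² ≢ 0 (mod ℓ),
-- so such u have valuation 0 and symbol +1, and they only remove the ℓ^(k−1)
-- multiples of ℓ from the case n = 0 with symbol +1. Finally
-- φ(ℓ^(e+1)) = 2h ℓ^e converts the counts into the stated form.

module Counting where

  open import Data.Nat using (ℕ; zero; suc; _+_; _*_; _<_; _≤_; _≟_; _<?_; s≤s)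
  open import Data.Nat.Properties
  open import Data.List using (List; []; _∷_; _++_; [_]; filter; length; map; upTo)
  open import Data.List.Properties using (filter-++; filter-≐; length-++; map-++; map-∘; map-id; map-upTo; upTo-∷ʳ)
  open import Data.List.Relation.Unary.All as All using (All; []; _∷_)
  open import Data.List.Relation.Unary.All.Properties using (all-upTo)
  open import Data.Product using (_×_; _,_; proj₂)
  open import Data.Sum using (inj₁; inj₂)
  open import Data.Empty using (⊥-elim)
  open import Function using (_∘_)
  open import Level using (0ℓ)
  open import Relation.Nullary using (¬_; yes; no)
  open import Relation.Nullary.Decidable using (_×-dec_; ¬?)
  open import Relation.Unary using (Pred; Decidable; _≐_)
  open import Relation.Binary.PropositionalEquality hiding ([_])
  open import Data.List.Membership.DecPropositional _≟_ using (_∈_; _∈?_)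
  open import Data.List.Relation.Unary.Any using (here; there)
  open import Data.List.Relation.Unary.AllPairs using (_∷_)
  open import Data.List.Relation.Unary.Unique.Propositional using (Unique)

  count : {A : Set} {P : Pred A 0ℓ} → Decidable P → List A → ℕ
  count P? xs = length (filter P? xs)

  module _ {A : Set} {P Q : Pred A 0ℓ} (P? : Decidable P) (Q? : Decidable Q) where

    count-≐ : P ≐ Q → ∀ xs → count P? xs ≡ count Q? xs
    count-≐ P≐Q xs = cong length (filter-≐ P? Q? P≐Q xs)

    count-≐-All : {R : Pred A 0ℓ} {xs : List A} → All R xs →
      (∀ {x} → R x → P x → Q x) → (∀ {x} → R x → Q x → P x) → count P? xs ≡ count Q? xs
    count-≐-All [] _ _ = refl
    count-≐-All {xs = x ∷ xs} (r ∷ rs) P⇒Q Q⇒P with P? x | Q? x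
    ... | yes _ | yes _ = cong suc (count-≐-All rs P⇒Q Q⇒P)
    ... | yes p | no ¬q = ⊥-elim (¬q (P⇒Q r p))
    ... | no ¬p | yes q = ⊥-elim (¬p (Q⇒P r q))
    ... | no _  | no _  = count-≐-All rs P⇒Q Q⇒P

    count-split : ∀ xs → count P? xs ≡ count (λ x → P? x ×-dec Q? x) xs + count (λ x → P? x ×-dec ¬? (Q? x)) xs
    count-split [] = refl
    count-split (x ∷ xs) with P? x | Q? x
    ... | yes _ | yes _ = cong suc (count-split xs)
    ... | yes _ | no _  = trans (cong suc (count-split xs)) (sym (+-suc _ _))
    ... | no _  | yes _ = count-split xs
    ... | no _  | no _  = count-split xs

  module _ {A : Set} {P : Pred A 0ℓ} (P? : Decidable P) where

    count-none : ∀ {xs} → All (¬_ ∘ P) xs → count P? xs ≡ 0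
    count-none [] = refl
    count-none {x ∷ _} (¬p ∷ ¬ps) with P? x
    ... | yes p = ⊥-elim (¬p p)
    ... | no _  = count-none ¬ps

    count-all : ∀ {xs} → All P xs → count P? xs ≡ length xs
    count-all [] = refl
    count-all {x ∷ _} (p ∷ ps) with P? x
    ... | yes _  = cong suc (count-all ps)
    ... | no ¬p = ⊥-elim (¬p p)

    count-+-count-∁ : ∀ xs → count P? xs + count (¬? ∘ P?) xs ≡ length xs
    count-+-count-∁ [] = refl
    count-+-count-∁ (x ∷ xs) with P? x
    ... | yes _ = cong suc (count-+-count-∁ xs)
    ... | no _  = trans (+-suc _ _) (cong suc (count-+-count-∁ xs))

    count-++ : ∀ xs ys → count P? (xs ++ ys) ≡ count P? xs + count P? ys
    count-++ xs ys = trans (cong length (filter-++ P? xs ys)) (length-++ (filter P? xs))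

    count-map : {B : Set} (f : B → A) → ∀ xs → count P? (map f xs) ≡ count (P? ∘ f) xs
    count-map f [] = refl
    count-map f (x ∷ xs) with P? (f x)
    ... | yes _ = cong suc (count-map f xs)
    ... | no _  = count-map f xs

  count-upTo-suc : {P : Pred ℕ 0ℓ} (P? : Decidable P) → ∀ n → count P? (upTo (suc n)) ≡ count P? (upTo n) + count P? [ n ]
  count-upTo-suc P? n = trans (cong (count P?) (sym (upTo-∷ʳ n))) (count-++ P? (upTo n) [ n ])

  count-≟-upTo : ∀ {c n} → c < n → count (_≟ c) (upTo n) ≡ 1
  count-≟-upTo {c} {suc n} (s≤s c≤n) with m≤n⇒m<n∨m≡n c≤n
  ... | inj₁ c<n = trans (count-upTo-suc (_≟ c) n)
    (cong₂ _+_ (count-≟-upTo c<n) (count-none (_≟ c) ((λ n≡c → <-irrefl (sym n≡c) c<n) ∷ [])))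
  ... | inj₂ refl = trans (count-upTo-suc (_≟ c) c)
    (cong₂ _+_ (count-none (_≟ c) (All.map (λ x<c x≡c → <-irrefl x≡c x<c) (all-upTo c))) (count-all (_≟ c) (refl ∷ [])))

  count-upTo-unique : {P : Pred ℕ 0ℓ} (P? : Decidable P) → ∀ {n c} → c < n → P c →
    (∀ {x} → x < n → P x → x ≡ c) → count P? (upTo n) ≡ 1
  count-upTo-unique P? {n} c<n Pc unique =
    trans (count-≐-All P? (_≟ _) (all-upTo n) unique (λ { _ refl → Pc })) (count-≟-upTo c<n)

  upTo-suc : ∀ n → upTo (suc n) ≡ 0 ∷ map suc (upTo n)
  upTo-suc n = cong (0 ∷_) (sym (map-upTo suc n))

  upTo-+ : ∀ m n → upTo (m + n) ≡ upTo m ++ map (m +_) (upTo n)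
  upTo-+ zero n = sym (map-id (upTo n))
  upTo-+ (suc m) n = begin
    upTo (suc (m + n))
      ≡⟨ upTo-suc (m + n) ⟩
    0 ∷ map suc (upTo (m + n))
      ≡⟨ cong (λ xs → 0 ∷ map suc xs) (upTo-+ m n) ⟩
    0 ∷ map suc (upTo m ++ map (m +_) (upTo n))
      ≡⟨ cong (0 ∷_) (map-++ suc (upTo m) _) ⟩
    0 ∷ (map suc (upTo m) ++ map suc (map (m +_) (upTo n)))
      ≡⟨ cong (λ xs → 0 ∷ (map suc (upTo m) ++ xs)) (sym (map-∘ (upTo n))) ⟩
    (0 ∷ map suc (upTo m)) ++ map (suc m +_) (upTo n)
      ≡⟨ cong (_++ map (suc m +_) (upTo n)) (sym (upTo-suc m)) ⟩
    upTo (suc m) ++ map (suc m +_) (upTo n) ∎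
    where open ≡-Reasoning

  count-upTo-periodic : {P : Pred ℕ 0ℓ} (P? : Decidable P) → ∀ m → (∀ {x} → P (m + x) → P x) → (∀ {x} → P x → P (m + x)) →
    ∀ q → count P? (upTo (q * m)) ≡ q * count P? (upTo m)
  count-upTo-periodic P? m shift⁻ shift⁺ zero = refl
  count-upTo-periodic P? m shift⁻ shift⁺ (suc q) = begin
    count P? (upTo (m + q * m))
      ≡⟨ cong (count P?) (upTo-+ m (q * m)) ⟩
    count P? (upTo m ++ map (m +_) (upTo (q * m)))
      ≡⟨ count-++ P? (upTo m) _ ⟩
    count P? (upTo m) + count P? (map (m +_) (upTo (q * m)))
      ≡⟨ cong (count P? (upTo m) +_) (count-map P? (m +_) (upTo (q * m))) ⟩
    count P? (upTo m) + count (P? ∘ (m +_)) (upTo (q * m))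
      ≡⟨ cong (count P? (upTo m) +_) (count-≐ (P? ∘ (m +_)) P? (shift⁻ , shift⁺) (upTo (q * m))) ⟩
    count P? (upTo m) + count P? (upTo (q * m))
      ≡⟨ cong (count P? (upTo m) +_) (count-upTo-periodic P? m shift⁻ shift⁺ q) ⟩
    count P? (upTo m) + q * count P? (upTo m) ∎
    where open ≡-Reasoning

  module _ {A : Set} {P : Pred A 0ℓ} {Q : Pred ℕ 0ℓ} (P? : Decidable P) (Q? : Decidable Q) (f : A → ℕ) where

    count-fibres : ∀ {b c} xs → (∀ {x} → P x → f x < b) →
      (∀ {r} → r < b → count (λ x → P? x ×-dec (f x ≟ r)) xs ≡ c) →
      count (λ x → P? x ×-dec Q? (f x)) xs ≡ c * count Q? (upTo b)
    count-fibres {b} {c} xs f<b fibre =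
      trans (count-≐ _ (below? b) ((λ (p , q) → p , f<b p , q) , (λ (p , _ , q) → p , q)) xs) (go b ≤-refl)
      where
      below? : ∀ b′ → Decidable (λ x → P x × f x < b′ × Q (f x))
      below? b′ x = P? x ×-dec (f x <? b′ ×-dec Q? (f x))

      go : ∀ b′ → b′ ≤ b → count (below? b′) xs ≡ c * count Q? (upTo b′)
      go zero _ = trans (count-none (below? zero) (All.universal (λ { _ (_ , () , _) }) xs)) (sym (*-zeroʳ c))
      go (suc b′) b′<b = begin
        count (below? (suc b′)) xs
          ≡⟨ count-split (below? (suc b′)) (λ x → f x ≟ b′) xs ⟩
        count (λ x → below? (suc b′) x ×-dec (f x ≟ b′)) xs + count (λ x → below? (suc b′) x ×-dec ¬? (f x ≟ b′)) xs
          ≡⟨ cong₂ _+_ at-b′ below-b′ ⟩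
        c * count Q? [ b′ ] + c * count Q? (upTo b′)
          ≡⟨ +-comm (c * count Q? [ b′ ]) _ ⟩
        c * count Q? (upTo b′) + c * count Q? [ b′ ]
          ≡⟨ *-distribˡ-+ c (count Q? (upTo b′)) _ ⟨
        c * (count Q? (upTo b′) + count Q? [ b′ ])
          ≡⟨ cong (c *_) (sym (count-upTo-suc Q? b′)) ⟩
        c * count Q? (upTo (suc b′)) ∎
        where
        open ≡-Reasoning
        below-b′ : count (λ x → below? (suc b′) x ×-dec ¬? (f x ≟ b′)) xs ≡ c * count Q? (upTo b′)
        below-b′ = trans (count-≐ _ (below? b′)
          ((λ ((p , lt , q) , ≢b′) → p , ≤∧≢⇒< (≤-pred lt) ≢b′ , q) , (λ (p , lt , q) → (p , m≤n⇒m≤1+n lt , q) , <⇒≢ lt)) xs)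
          (go b′ (<⇒≤ b′<b))
        at-b′ : count (λ x → below? (suc b′) x ×-dec (f x ≟ b′)) xs ≡ c * count Q? [ b′ ]
        at-b′ with Q? b′
        ... | yes Qb′ = trans (count-≐ _ (λ x → P? x ×-dec (f x ≟ b′))
              ((λ ((p , _) , e) → p , e) , (λ { (p , refl) → (p , ≤-refl , Qb′) , refl })) xs)
              (trans (fibre b′<b) (sym (*-identityʳ c)))
        ... | no ¬Qb′ = trans (count-none _ (All.universal (λ { _ ((_ , _ , q) , refl) → ¬Qb′ q }) xs)) (sym (*-zeroʳ c))

  count-∈-upTo : ∀ {n ys} → Unique ys → All (_< n) ys → count (_∈? ys) (upTo n) ≡ length ys
  count-∈-upTo {n} {[]} _ _ = count-none (_∈? []) (All.universal (λ _ ()) (upTo n))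
  count-∈-upTo {n} {y ∷ ys} (y∉ys ∷ unique) (y<n ∷ ys<n) = begin
    count (_∈? y ∷ ys) (upTo n)
      ≡⟨ count-split (_∈? y ∷ ys) (_≟ y) (upTo n) ⟩
    count (λ x → (x ∈? y ∷ ys) ×-dec (x ≟ y)) (upTo n) + count (λ x → (x ∈? y ∷ ys) ×-dec ¬? (x ≟ y)) (upTo n)
      ≡⟨ cong₂ _+_ at-y off-y ⟩
    suc (length ys) ∎
    where
    open ≡-Reasoning
    x∈ys⇒≢y : ∀ {x} → x ∈ ys → x ≢ y
    x∈ys⇒≢y x∈ys refl = All.lookup y∉ys x∈ys refl
    drop-y : ∀ {x} → x ∈ y ∷ ys × x ≢ y → x ∈ ys
    drop-y (here x≡y , x≢y) = ⊥-elim (x≢y x≡y)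
    drop-y (there x∈ys , _) = x∈ys
    at-y : count (λ x → (x ∈? y ∷ ys) ×-dec (x ≟ y)) (upTo n) ≡ 1
    at-y = trans (count-≐ _ (_≟ y) (proj₂ , λ e → here e , e) (upTo n)) (count-≟-upTo y<n)
    off-y : count (λ x → (x ∈? y ∷ ys) ×-dec ¬? (x ≟ y)) (upTo n) ≡ length ys
    off-y = trans (count-≐ _ (_∈? ys) (drop-y , λ x∈ys → there x∈ys , x∈ys⇒≢y x∈ys) (upTo n))
                  (count-∈-upTo unique ys<n)

open Counting

module EuclideanDivision where

  open import Data.Nat as ℕ using (ℕ; zero; suc; _<_; NonZero)
  import Data.Nat.Properties as ℕ
  open import Data.Nat.Divisibility using (_∣_; >⇒∤)
  open import Data.Integer using (ℤ; 0ℤ; +_; -[1+_]; ∣_∣; _+_; _-_; _*_; _%ℕ_; _/ℕ_)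
  open import Data.Integer.Properties
  open import Data.Integer.DivMod using (a≡a%ℕn+[a/ℕn]*n; n%ℕd<d)
  open import Data.Integer.Divisibility.Signed using (divides; ∣⇒∣ᵤ) renaming (_∣_ to _∣ℤ_)
  open import Data.Integer.Tactic.RingSolver using (solve-∀)
  open import Algebra.Bundles using (AbelianGroup)
  open import Algebra.Properties.Group (AbelianGroup.group +-0-abelianGroup) using () renaming (∙-cancelˡ to +-cancelˡ)
  open import Data.Product using (_×_; _,_)
  open import Relation.Nullary using (contradiction)
  open import Relation.Binary.PropositionalEquality

  i*i≡+∣i∣² : ∀ i → i * i ≡ + (∣ i ∣ ℕ.* ∣ i ∣)
  i*i≡+∣i∣² (+ n)    = sym (pos-* n n)
  i*i≡+∣i∣² -[1+ n ] = refl

  ∣∧<⇒≡0 : ∀ {m x} → m ∣ x → x < m → x ≡ 0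
  ∣∧<⇒≡0 {x = zero}  _   _   = refl
  ∣∧<⇒≡0 {x = suc _} m∣x x<m = contradiction m∣x (>⇒∤ x<m)

  ∣[u-v]∧<⇒≡ : ∀ {m u v} → u < m → v < m → + m ∣ℤ + u - + v → u ≡ v
  ∣[u-v]∧<⇒≡ {m} {u} {v} u<m v<m m∣u-v = +-injective (i-j≡0⇒i≡j (+ u) (+ v) (∣i∣≡0⇒i≡0 ∣u-v∣≡0))
    where
    ∣u-v∣<m : ∣ + u - + v ∣ < m
    ∣u-v∣<m = subst (_< m) (cong ∣_∣ (sym ([+m]-[+n]≡m⊖n u v)))
      (ℕ.≤-<-trans (∣m⊝n∣≤m⊔n u v) (ℕ.⊔-lub u<m v<m))
    ∣u-v∣≡0 : ∣ + u - + v ∣ ≡ 0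
    ∣u-v∣≡0 = ∣∧<⇒≡0 (∣⇒∣ᵤ m∣u-v) ∣u-v∣<m

  remainders-differ-by-multiple : ∀ {x : ℤ} r s (Q W d : ℤ) → x ≡ r + Q * d → x ≡ s + W * d → r - s ≡ (W - Q) * d
  remainders-differ-by-multiple {x} r s Q W d x≡r+Qd x≡s+Wd = begin
    r - s                                       ≡⟨ regroup r s Q W d ⟩
    (r + Q * d) - (s + W * d) + (W - Q) * d     ≡⟨ cong₂ (λ y z → y - z + (W - Q) * d) (sym x≡r+Qd) (sym x≡s+Wd) ⟩
    x - x + (W - Q) * d                         ≡⟨ cong (_+ (W - Q) * d) (+-inverseʳ x) ⟩
    0ℤ + (W - Q) * d                            ≡⟨ +-identityˡ _ ⟩
    (W - Q) * d                                 ∎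
    where
    open ≡-Reasoning
    regroup : ∀ r s Q W d → r - s ≡ (r + Q * d) - (s + W * d) + (W - Q) * d
    regroup = solve-∀

  module _ {a : ℤ} {d r : ℕ} {q : ℤ} .{{_ : NonZero d}} (r<d : r < d) (a≡r+qd : a ≡ + r + q * + d) where

    %ℕ-unique : a %ℕ d ≡ r
    %ℕ-unique = sym (∣[u-v]∧<⇒≡ r<d (n%ℕd<d a d)
      (divides (a /ℕ d - q) (remainders-differ-by-multiple (+ r) (+ (a %ℕ d)) q (a /ℕ d) (+ d) a≡r+qd (a≡a%ℕn+[a/ℕn]*n a d))))

    /ℕ-unique : a /ℕ d ≡ q
    /ℕ-unique = *-cancelʳ-≡ (a /ℕ d) q (+ d) (+-cancelˡ (+ r) _ _ (begin
      + r + a /ℕ d * + d             ≡⟨ cong (λ s → + s + a /ℕ d * + d) %ℕ-unique ⟨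
      + (a %ℕ d) + a /ℕ d * + d      ≡⟨ a≡a%ℕn+[a/ℕn]*n a d ⟨
      a                              ≡⟨ a≡r+qd ⟩
      + r + q * + d                  ∎))
      where open ≡-Reasoning

  *-/ℕ-cancel : ∀ (q : ℤ) d .{{_ : NonZero d}} → (q * + d) /ℕ d ≡ q
  *-/ℕ-cancel q d = /ℕ-unique {r = 0} (ℕ.>-nonZero⁻¹ d) (sym (+-identityˡ (q * + d)))

  %ℕ-cong : ∀ {X Y : ℤ} {d} .{{_ : NonZero d}} → + d ∣ℤ X - Y → X %ℕ d ≡ Y %ℕ d
  %ℕ-cong {X} {Y} {d} (divides k X-Y≡kd) = %ℕ-unique {q = Y /ℕ d + k} (n%ℕd<d Y d) (begin
    X                                       ≡⟨ shift X Y ⟩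
    Y + (X - Y)                             ≡⟨ cong₂ (λ y z → y + z) (a≡a%ℕn+[a/ℕn]*n Y d) X-Y≡kd ⟩
    + (Y %ℕ d) + Y /ℕ d * + d + k * + d      ≡⟨ regroup (+ (Y %ℕ d)) (Y /ℕ d) k (+ d) ⟩
    + (Y %ℕ d) + (Y /ℕ d + k) * + d         ∎)
    where
    open ≡-Reasoning
    shift : ∀ X Y → X ≡ Y + (X - Y)
    shift = solve-∀
    regroup : ∀ r q k d → r + q * d + k * d ≡ r + (q + k) * d
    regroup = solve-∀

  module _ {X : ℤ} {d m r : ℕ} .{{_ : NonZero d}} .{{_ : NonZero m}} where

    ∣∧quotient%≡⇒∣ : + d ∣ℤ X → (X /ℕ d) %ℕ m ≡ r → + (m ℕ.* d) ∣ℤ X - + d * + r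
    ∣∧quotient%≡⇒∣ (divides q refl) q%m≡r = divides (q /ℕ m) (begin
      q * + d - + d * + r
        ≡⟨ cong (λ s → q * + d - + d * + s) (trans (sym q%m≡r) (cong (_%ℕ m) (*-/ℕ-cancel q d))) ⟩
      q * + d - + d * + (q %ℕ m)
        ≡⟨ cong (λ s → s * + d - + d * + (q %ℕ m)) (a≡a%ℕn+[a/ℕn]*n q m) ⟩
      (+ (q %ℕ m) + q /ℕ m * + m) * + d - + d * + (q %ℕ m)
        ≡⟨ cancel (+ (q %ℕ m)) (q /ℕ m) (+ m) (+ d) ⟩
      q /ℕ m * (+ m * + d)
        ≡⟨ cong (q /ℕ m *_) (pos-* m d) ⟨
      q /ℕ m * + (m ℕ.* d) ∎)
      where
      open ≡-Reasoning
      cancel : ∀ r Q m d → (r + Q * m) * d - d * r ≡ Q * (m * d)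
      cancel = solve-∀

    ∣⇒∣∧quotient%≡ : r < m → + (m ℕ.* d) ∣ℤ X - + d * + r → + d ∣ℤ X × (X /ℕ d) %ℕ m ≡ r
    ∣⇒∣∧quotient%≡ r<m (divides w X-dr≡wmd) = divides (+ r + w * + m) X≡[r+wm]d , (begin
      (X /ℕ d) %ℕ m                 ≡⟨ cong (λ Y → (Y /ℕ d) %ℕ m) X≡[r+wm]d ⟩
      ((+ r + w * + m) * + d /ℕ d) %ℕ m ≡⟨ cong (_%ℕ m) (*-/ℕ-cancel (+ r + w * + m) d) ⟩
      (+ r + w * + m) %ℕ m          ≡⟨ %ℕ-unique {q = w} r<m refl ⟩
      r                             ∎)
      where
      open ≡-Reasoning
      X≡[r+wm]d : X ≡ (+ r + w * + m) * + d
      X≡[r+wm]d = begin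
        X                             ≡⟨ shift X (+ d) (+ r) ⟩
        (X - + d * + r) + + d * + r   ≡⟨ cong (_+ + d * + r) (trans X-dr≡wmd (cong (w *_) (pos-* m d))) ⟩
        w * (+ m * + d) + + d * + r   ≡⟨ regroup w (+ m) (+ d) (+ r) ⟩
        (+ r + w * + m) * + d         ∎
        where
        shift : ∀ X d r → X ≡ (X - d * r) + d * r
        shift = solve-∀
        regroup : ∀ w m d r → w * (m * d) + d * r ≡ (r + w * m) * d
        regroup = solve-∀

open EuclideanDivision

module LinearCongruence where

  open import Data.Nat as ℕ using (ℕ; zero; suc; _<_; _%_; _/_; s≤s)
  open import Data.Nat.DivMod using (m%n<n; m≡m%n+[m/n]*n)
  open import Relation.Nullary using (¬_; contradiction)
  open import Data.Nat.Divisibility using (_∣_; _∣?_) renaming (divides to dividesᴺ)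
  open import Data.Integer using (ℤ; +_; ∣_∣; _+_; _-_; _*_; _%ℕ_; _/ℕ_)
  open import Data.Integer.DivMod using (a≡a%ℕn+[a/ℕn]*n; n%ℕd<d)
  open import Data.Integer.Divisibility.Signed using (divides; ∣⇒∣ᵤ; ∣ᵤ⇒∣; ∣-refl; ∣m∣n⇒∣m+n; ∣m+n∣n⇒∣m; ∣m∣n⇒∣m-n; ∣n⇒∣m*n)
    renaming (_∣_ to _∣ℤ_)
  open import Data.Integer.Tactic.RingSolver using (solve-∀)
  open import Data.List using (upTo)
  open import Data.Product using (_×_; _,_; Σ-syntax; ∃-syntax)
  open import Data.Nat.Tactic.RingSolver using () renaming (solve-∀ to ℕ-solve-∀)
  open import Function using (_∘_)
  open import Data.Integer.Properties using (pos-+)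
  import Data.Nat.Properties as ℕ
  open import Relation.Unary using (Decidable)
  open import Relation.Binary.PropositionalEquality

  Odd : ℕ → Set
  Odd m = ∃[ c ] m ≡ suc (c ℕ.+ c)

  ∤2⇒odd : ∀ {n} → ¬ 2 ∣ n → Odd n
  ∤2⇒odd {n} 2∤n with n % 2 | m%n<n n 2 | m≡m%n+[m/n]*n n 2
  ... | 0 | _ | n≡[n/2]*2 = contradiction (dividesᴺ (n / 2) n≡[n/2]*2) 2∤n
  ... | 1 | _ | n≡1+[n/2]*2 =
    n / 2 , trans n≡1+[n/2]*2 (cong suc (trans (ℕ.*-comm (n / 2) 2) (cong (n / 2 ℕ.+_) (ℕ.+-identityʳ (n / 2)))))
  ... | suc (suc _) | s≤s (s≤s ()) | _

  odd-* : ∀ {m n} → Odd m → Odd n → Odd (m ℕ.* n)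
  odd-* (c , refl) (d , refl) = c ℕ.+ d ℕ.+ (c ℕ.* d ℕ.+ c ℕ.* d) , expand c d
    where
    expand : ∀ c d → suc (c ℕ.+ c) ℕ.* suc (d ℕ.+ d)
                     ≡ suc ((c ℕ.+ d ℕ.+ (c ℕ.* d ℕ.+ c ℕ.* d)) ℕ.+ (c ℕ.+ d ℕ.+ (c ℕ.* d ℕ.+ c ℕ.* d)))
    expand = ℕ-solve-∀

  odd-^ : ∀ {m} → Odd m → ∀ j → Odd (m ℕ.^ j)
  odd-^ _     zero    = 0 , refl
  odd-^ m-odd (suc j) = odd-* m-odd (odd-^ m-odd j)

  module OddModulus (c : ℕ) where

    private
      m : ℕ
      m = suc (c ℕ.+ c)
      w : ℤ
      -- 4 (c + 1)² = m² + 2m + 1, so w inverts 4 modulo m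
      w = + suc c * + suc c

    ∣4x⇒∣x : ∀ {x} → + m ∣ℤ + 4 * x → + m ∣ℤ x
    ∣4x⇒∣x {x} (divides k 4x≡km) = divides (w * k - (+ m + + 2) * x) (begin
      x                                     ≡⟨ invert-4 (+ c) x ⟩
      w * (+ 4 * x) - (+ m + + 2) * x * + m ≡⟨ cong (λ y → w * y - (+ m + + 2) * x * + m) 4x≡km ⟩
      w * (k * + m) - (+ m + + 2) * x * + m ≡⟨ factor-m w k x (+ m) ⟩
      (w * k - (+ m + + 2) * x) * + m       ∎)
      where
      open ≡-Reasoning
      invert-4 : ∀ c x → x ≡ ((+ 1 + c) * (+ 1 + c)) * (+ 4 * x) - ((+ 1 + c + c) + + 2) * x * (+ 1 + c + c)
      invert-4 = solve-∀
      factor-m : ∀ w k x m → w * (k * m) - (m + + 2) * x * m ≡ (w * k - (m + + 2) * x) * m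
      factor-m = solve-∀

    linear-congruence-unique : ∀ (a : ℤ) {u v} → u < m → v < m →
      + m ∣ℤ a - + 4 * + u → + m ∣ℤ a - + 4 * + v → u ≡ v
    linear-congruence-unique a {u} {v} u<m v<m m∣a-4u m∣a-4v =
      ∣[u-v]∧<⇒≡ u<m v<m (∣4x⇒∣x (subst (+ m ∣ℤ_) (difference a (+ u) (+ v)) (∣m∣n⇒∣m-n m∣a-4v m∣a-4u)))
      where
      difference : ∀ a u v → (a - + 4 * v) - (a - + 4 * u) ≡ + 4 * (u - v)
      difference = solve-∀

    linear-congruence-solution : ∀ (a : ℤ) → Σ[ u ∈ ℕ ] u < m × + m ∣ℤ a - + 4 * + u
    linear-congruence-solution a = u , n%ℕd<d (a * w) m , divides (+ 4 * q - a * (+ m + + 2)) (begin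
      a - + 4 * + u                           ≡⟨ shift a (+ u) q (+ m) ⟩
      a - + 4 * (+ u + q * + m) + + 4 * q * + m ≡⟨ cong (λ y → a - + 4 * y + + 4 * q * + m) (a≡a%ℕn+[a/ℕn]*n (a * w) m) ⟨
      a - + 4 * (a * w) + + 4 * q * + m       ≡⟨ reduce a q (+ c) ⟩
      (+ 4 * q - a * (+ m + + 2)) * + m       ∎)
      where
      open ≡-Reasoning
      u : ℕ
      u = (a * w) %ℕ m
      q : ℤ
      q = (a * w) /ℕ m
      shift : ∀ a u q m → a - + 4 * u ≡ a - + 4 * (u + q * m) + + 4 * q * m
      shift = solve-∀
      reduce : ∀ a q c → a - + 4 * (a * ((+ 1 + c) * (+ 1 + c))) + + 4 * q * (+ 1 + c + c)
                         ≡ (+ 4 * q - a * ((+ 1 + c + c) + + 2)) * (+ 1 + c + c)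
      reduce = solve-∀

    count-linear-congruence-2c+1 : ∀ (a : ℤ) q → count (λ u → m ∣? ∣ a - + 4 * + u ∣) (upTo (q ℕ.* m)) ≡ q
    count-linear-congruence-2c+1 a q with linear-congruence-solution a
    ... | u , u<m , m∣a-4u = begin
      count P? (upTo (q ℕ.* m))
        ≡⟨ count-upTo-periodic P? m (∣⇒∣ᵤ ∘ shift⁻ ∘ ∣ᵤ⇒∣) (∣⇒∣ᵤ ∘ shift⁺ ∘ ∣ᵤ⇒∣) q ⟩
      q ℕ.* count P? (upTo m)
        ≡⟨ cong (q ℕ.*_) (count-upTo-unique P? u<m (∣⇒∣ᵤ m∣a-4u)
             (λ x<m m∣ → linear-congruence-unique a x<m u<m (∣ᵤ⇒∣ m∣) m∣a-4u)) ⟩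
      q ℕ.* 1
        ≡⟨ ℕ.*-identityʳ q ⟩
      q ∎
      where
      open ≡-Reasoning
      P? : Decidable (λ u → m ∣ ∣ a - + 4 * + u ∣)
      P? u = m ∣? ∣ a - + 4 * + u ∣
      shift : ∀ x → a - + 4 * + x ≡ (a - + 4 * + (m ℕ.+ x)) + + 4 * + m
      shift x = trans (regroup a (+ m) (+ x)) (cong (λ y → (a - + 4 * y) + + 4 * + m) (sym (pos-+ m x)))
        where
        regroup : ∀ a m x → a - + 4 * x ≡ (a - + 4 * (m + x)) + + 4 * m
        regroup = solve-∀
      shift⁻ : ∀ {x} → + m ∣ℤ a - + 4 * + (m ℕ.+ x) → + m ∣ℤ a - + 4 * + x
      shift⁻ {x} m∣ = subst (+ m ∣ℤ_) (sym (shift x)) (∣m∣n⇒∣m+n m∣ (∣n⇒∣m*n (+ 4) ∣-refl))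
      shift⁺ : ∀ {x} → + m ∣ℤ a - + 4 * + x → + m ∣ℤ a - + 4 * + (m ℕ.+ x)
      shift⁺ {x} m∣ = ∣m+n∣n⇒∣m (subst (+ m ∣ℤ_) (shift x) m∣) (∣n⇒∣m*n (+ 4) ∣-refl)

  count-linear-congruence : ∀ {m} → Odd m → ∀ (a : ℤ) q → count (λ u → m ∣? ∣ a - + 4 * + u ∣) (upTo (q ℕ.* m)) ≡ q
  count-linear-congruence (c , refl) = OddModulus.count-linear-congruence-2c+1 c

open LinearCongruence

module TruncatedValuation where

  open import Data.Nat using (ℕ; zero; suc; _∸_; _^_; _<_; _≤_; z≤n; s≤s)
  open import Data.Nat.Properties
  open import Data.Nat.Divisibility using (_∣_; _∣?_; ∣-trans; m∣m*n; 1∣_)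
  open import Data.Integer using (∣_∣)
  open import Data.Product using (_×_; _,_)
  open import Data.Sum using (inj₁; inj₂)
  open import Function using (_⇔_; mk⇔)
  open import Relation.Nullary using (¬_; yes; no; contradiction)
  open import Relation.Binary.PropositionalEquality
  open import Defs using (νtrunc)

  module _ (ℓ : ℕ) where

    ^-∣-^ : ∀ {i j} → i ≤ j → ℓ ^ i ∣ ℓ ^ j
    ^-∣-^ {i} {j} i≤j = subst (ℓ ^ i ∣_) (trans (sym (^-distribˡ-+-* ℓ i (j ∸ i))) (cong (ℓ ^_) (m+[n∸m]≡n i≤j))) (m∣m*n _)

    νtrunc-∣ : ∀ k X → ℓ ^ νtrunc ℓ k X ∣ ∣ X ∣
    νtrunc-∣ zero    X = 1∣ _
    νtrunc-∣ (suc k) X with ℓ ^ suc k ∣? ∣ X ∣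
    ... | yes ℓ^k+1∣X = ℓ^k+1∣X
    ... | no _        = νtrunc-∣ k X

    νtrunc-≤ : ∀ k X → νtrunc ℓ k X ≤ k
    νtrunc-≤ zero    X = z≤n
    νtrunc-≤ (suc k) X with ℓ ^ suc k ∣? ∣ X ∣
    ... | yes _ = ≤-refl
    ... | no _  = m≤n⇒m≤1+n (νtrunc-≤ k X)

    νtrunc-maximal : ∀ k X {j} → νtrunc ℓ k X < j → j ≤ k → ¬ ℓ ^ j ∣ ∣ X ∣
    νtrunc-maximal zero    X (s≤s _) ()
    νtrunc-maximal (suc k) X {j} ν<j j≤k+1 with ℓ ^ suc k ∣? ∣ X ∣
    ... | yes _ = contradiction (≤-trans ν<j j≤k+1) (<-irrefl refl)
    ... | no ℓ^k+1∤X with m≤n⇒m<n∨m≡n j≤k+1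
    ...   | inj₁ j<k+1 = νtrunc-maximal k X ν<j (≤-pred j<k+1)
    ...   | inj₂ refl  = ℓ^k+1∤X

    νtrunc≡⇔ : ∀ {k n} X → n < k → νtrunc ℓ k X ≡ n ⇔ ((ℓ ^ n ∣ ∣ X ∣) × ¬ (ℓ ^ suc n ∣ ∣ X ∣))
    νtrunc≡⇔ {k} {n} X n<k = mk⇔
      (λ { refl → νtrunc-∣ k X , νtrunc-maximal k X ≤-refl n<k })
      (λ (ℓ^n∣X , ℓ^n+1∤X) → ≤-antisym (ν≤n ℓ^n+1∤X) (n≤ν ℓ^n∣X))
      where
      ν≤n : ¬ ℓ ^ suc n ∣ ∣ X ∣ → νtrunc ℓ k X ≤ n
      ν≤n ℓ^n+1∤X with νtrunc ℓ k X ≤? n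
      ... | yes ν≤n = ν≤n
      ... | no ν≰n  = contradiction (∣-trans (^-∣-^ (≰⇒> ν≰n)) (νtrunc-∣ k X)) ℓ^n+1∤X
      n≤ν : ℓ ^ n ∣ ∣ X ∣ → n ≤ νtrunc ℓ k X
      n≤ν ℓ^n∣X with n ≤? νtrunc ℓ k X
      ... | yes n≤ν = n≤ν
      ... | no n≰ν  = contradiction ℓ^n∣X (νtrunc-maximal k X (≰⇒> n≰ν) (<⇒≤ n<k))

    νtrunc≡k⇔ : ∀ k X → νtrunc ℓ k X ≡ k ⇔ ℓ ^ k ∣ ∣ X ∣
    νtrunc≡k⇔ k X = mk⇔ (λ ν≡k → subst (λ j → ℓ ^ j ∣ ∣ X ∣) ν≡k (νtrunc-∣ k X)) ν≡k
      where
      ν≡k : ℓ ^ k ∣ ∣ X ∣ → νtrunc ℓ k X ≡ k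
      ν≡k ℓ^k∣X with m≤n⇒m<n∨m≡n (νtrunc-≤ k X)
      ... | inj₁ ν<k = contradiction ℓ^k∣X (νtrunc-maximal k X ν<k ≤-refl)
      ... | inj₂ ν≡k = ν≡k

open TruncatedValuation

module PrimePowers where

  open import Data.Nat using (ℕ; zero; suc; _+_; _*_; _^_; _/_; _<_; z≤n; s≤s; nonTrivial⇒≢1; >-nonZero⁻¹)
  open import Data.Nat.Properties
  open import Data.Nat.DivMod using (m*n/n≡m)
  open import Data.Nat.Divisibility using (_∣_; _∣?_; ∣-trans; ∣-refl; m∣m*n; ∣1⇒≡1; _∣0; ∣m∣n⇒∣m+n; ∣m+n∣m⇒∣n)
  open import Data.Nat.Primality using (Prime; prime⇒irreducible; prime⇒nonTrivial; prime⇒nonZero)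
  open import Data.Nat.Coprimality using (Coprime; coprime?; coprime-divisor)
  open import Data.Nat.Tactic.RingSolver using (solve-∀)
  open import Data.List using (upTo; length)
  open import Function using (_∘_)
  open import Data.List.Properties using (length-upTo)
  open import Data.List.Relation.Unary.All as All using ()
  open import Data.Product using (_,_)
  open import Data.Sum using (inj₁; inj₂)
  open import Relation.Nullary using (¬_; contradiction)
  open import Relation.Nullary.Decidable using (¬?)
  open import Relation.Binary.PropositionalEquality
  open import Defs using (φ)

  module _ {p : ℕ} (p-prime : Prime p) where

    coprime-^⇒∤ : ∀ {u j} → 0 < j → Coprime u (p ^ j) → ¬ p ∣ u
    coprime-^⇒∤ {j = suc j} _ u⊥p^j+1 p∣u = nonTrivial⇒≢1 {{prime⇒nonTrivial p-prime}} (u⊥p^j+1 (p∣u , m∣m*n (p ^ j)))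

    ∤⇒coprime-^ : ∀ {u} j → ¬ p ∣ u → Coprime u (p ^ j)
    ∤⇒coprime-^ {u} j p∤u {d} (d∣u , d∣p^j) = ∣1⇒≡1 (peel j d∣p^j)
      where
      d⊥p : Coprime d p
      d⊥p (e∣d , e∣p) with prime⇒irreducible p-prime e∣p
      ... | inj₁ e≡1 = e≡1
      ... | inj₂ refl = contradiction (∣-trans e∣d d∣u) p∤u
      peel : ∀ i → d ∣ p ^ i → d ∣ 1
      peel zero    d∣1 = d∣1
      peel (suc i) d∣p^i+1 = peel i (coprime-divisor d⊥p d∣p^i+1)

    count-multiples : ∀ q → count (p ∣?_) (upTo (q * p)) ≡ q
    count-multiples q = begin
      count (p ∣?_) (upTo (q * p)) ≡⟨ count-upTo-periodic (p ∣?_) p (λ p∣p+x → ∣m+n∣m⇒∣n p∣p+x ∣-refl) (∣m∣n⇒∣m+n ∣-refl) q ⟩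
      q * count (p ∣?_) (upTo p)   ≡⟨ cong (q *_) (count-upTo-unique (p ∣?_) 0<p (p ∣0) (λ x<p p∣x → ∣∧<⇒≡0 p∣x x<p)) ⟩
      q * 1                        ≡⟨ *-identityʳ q ⟩
      q                            ∎
      where
      open ≡-Reasoning
      0<p : 0 < p
      0<p = >-nonZero⁻¹ p {{prime⇒nonZero p-prime}}

    φ-^ : ∀ e → φ (p ^ suc e) + p ^ e ≡ p ^ suc e
    φ-^ e = begin
      φ N + p ^ e
        ≡⟨ cong₂ _+_ φ≡count-∤ (sym (count-multiples (p ^ e))) ⟩
      count (¬? ∘ (p ∣?_)) (upTo N) + count (p ∣?_) (upTo (p ^ e * p))
        ≡⟨ cong (λ n → count (¬? ∘ (p ∣?_)) (upTo N) + count (p ∣?_) (upTo n)) (*-comm (p ^ e) p) ⟩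
      count (¬? ∘ (p ∣?_)) (upTo N) + count (p ∣?_) (upTo N)
        ≡⟨ +-comm _ (count (p ∣?_) (upTo N)) ⟩
      count (p ∣?_) (upTo N) + count (¬? ∘ (p ∣?_)) (upTo N)
        ≡⟨ count-+-count-∁ (p ∣?_) (upTo N) ⟩
      length (upTo N)
        ≡⟨ length-upTo N ⟩
      N ∎
      where
      open ≡-Reasoning
      N : ℕ
      N = p ^ suc e
      φ≡count-∤ : φ N ≡ count (¬? ∘ (p ∣?_)) (upTo N)
      φ≡count-∤ = count-≐ (λ x → coprime? x N) (¬? ∘ (p ∣?_)) (coprime-^⇒∤ {j = suc e} (s≤s z≤n) , ∤⇒coprime-^ (suc e)) (upTo N)

  φ-^/2 : ∀ h → Prime (suc (h + h)) → ∀ e → φ (suc (h + h) ^ suc e) / 2 ≡ suc (h + h) ^ e * h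
  φ-^/2 h p-prime e = trans (cong (_/ 2) φ≡) (m*n/n≡m (q * h) 2)
    where
    q : ℕ
    q = suc (h + h) ^ e
    φ≡ : φ (suc (h + h) * q) ≡ q * h * 2
    φ≡ = +-cancelʳ-≡ q _ _ (trans (φ-^ p-prime e) (expand h q))
      where
      expand : ∀ h q → suc (h + h) * q ≡ q * h * 2 + q
      expand = solve-∀

open PrimePowers

module QuadraticResidues where

  open import Data.Bool using (true; false; if_then_else_; T)
  open import Data.Bool.ListAction using (any)
  open import Data.Nat as ℕ using (ℕ; zero; suc; _+_; _*_; _∸_; _/_; _%_; _<_; _≤_; _≡ᵇ_; _≟_; _<?_; z≤n; s≤s)
  open import Data.Nat.Properties
  open import Data.Nat.DivMod using (m≡m%n+[m/n]*n; m%n<n; [m+kn]%n≡m%n)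
  open import Data.Nat.Divisibility using (m%n≡0⇒n∣m)
  open import Data.Nat.Divisibility using (_∣_; n∣m*n)
  open import Data.Nat.Primality using (Prime; euclidsLemma)
  open import Data.Nat.Tactic.RingSolver using (solve-∀)
  open import Data.Integer as ℤ using (ℤ; +_)
  open import Data.List using (List; upTo; applyUpTo; length)
  open import Data.List.Properties using (length-applyUpTo; length-upTo)
  open import Function using (_∘_)
  open import Relation.Nullary.Decidable using (¬?; _×-dec_)
  open import Data.List.Membership.DecPropositional _≟_ using (_∈?_)
  open import Data.List.Relation.Unary.All using (All)
  import Data.List.Relation.Unary.All.Properties as All
  open import Data.List.Relation.Unary.Unique.Propositional using (Unique)
  import Data.List.Relation.Unary.Unique.Propositional.Properties as Unique
  open import Data.List.Membership.Propositional using (_∈_; find)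
  open import Data.List.Membership.Propositional.Properties using (∈-upTo⁺; ∈-upTo⁻; ∈-applyUpTo⁺; ∈-applyUpTo⁻)
  open import Data.List.Relation.Unary.Any as Any using (Any)
  open import Data.List.Relation.Unary.Any.Properties using (any⁺; any⁻)
  open import Data.Product using (_×_; _,_; proj₂; ∃-syntax)
  open import Data.Sum using (_⊎_; inj₁; inj₂)
  open import Relation.Nullary using (¬_; contradiction; yes; no)
  open import Relation.Unary using (Decidable)
  open import Relation.Binary.PropositionalEquality

  -- The Legendre symbol of the residue r modulo suc m: legendre a (suc m) unfolds to
  -- residueSymbol m (a %ℕ suc m).
  residueSymbol : ℕ → ℕ → ℤ
  residueSymbol m r =
    if r ≡ᵇ 0 then + 0
    else if any (λ x → (x * x) % suc m ≡ᵇ r) (upTo (suc m)) then + 1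
    else ℤ.- (+ 1)

  module _ (h : ℕ) (p-prime : Prime (suc (h + h))) where

    private
      p : ℕ
      p = suc (h + h)
      χ : ℕ → ℤ
      χ = residueSymbol (h + h)

    square⇒χ≡1 : ∀ {r x} → r ≢ 0 → x < p → (x * x) % p ≡ r → χ r ≡ + 1
    square⇒χ≡1 {zero} r≢0 _ _ = contradiction refl r≢0
    square⇒χ≡1 {suc r} {x} _ x<p x²≡r with any (λ y → (y * y) % p ≡ᵇ suc r) (upTo p) in eq
    ... | true  = refl
    ... | false = contradiction (subst T eq (any⁺ (λ y → (y * y) % p ≡ᵇ suc r) root)) λ ()
      where
      root : Any (λ y → T ((y * y) % p ≡ᵇ suc r)) (upTo p)
      root = Any.map (λ { refl → ≡⇒≡ᵇ _ _ x²≡r }) (∈-upTo⁺ x<p)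

    χ≡1⇒square : ∀ {r} → χ r ≡ + 1 → r ≢ 0 × ∃[ x ] x < p × (x * x) % p ≡ r
    χ≡1⇒square {suc r} χ≡1 with any (λ y → (y * y) % p ≡ᵇ suc r) (upTo p) in eq
    ... | true  = let (x , x∈ , x²≡r) = find (any⁻ (λ y → (y * y) % p ≡ᵇ suc r) (upTo p) (subst T (sym eq) _)) in
                  (λ ()) , x , ∈-upTo⁻ x∈ , ≡ᵇ⇒≡ _ _ x²≡r

    χ-nonzero : ∀ {r} → r ≢ 0 → χ r ≡ + 1 ⊎ χ r ≡ ℤ.- (+ 1)
    χ-nonzero {zero} r≢0 = contradiction refl r≢0
    χ-nonzero {suc r} _ with any (λ y → (y * y) % p ≡ᵇ suc r) (upTo p)
    ... | true  = inj₁ refl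
    ... | false = inj₂ refl

    [m+n]%p≡m%p⇒p∣n : ∀ m n → (m + n) % p ≡ m % p → p ∣ n
    [m+n]%p≡m%p⇒p∣n m n eq = subst (p ∣_) (sym n≡[q′∸q]*p) (n∣m*n (q′ ∸ q))
      where
      q′ q : ℕ
      q′ = (m + n) / p
      q  = m / p
      n≡[q′∸q]*p : n ≡ (q′ ∸ q) * p
      n≡[q′∸q]*p = begin
        n                                     ≡⟨ m+n∸m≡n m n ⟨
        (m + n) ∸ m                           ≡⟨ cong₂ _∸_ (m≡m%n+[m/n]*n (m + n) p) (m≡m%n+[m/n]*n m p) ⟩
        ((m + n) % p + q′ * p) ∸ (m % p + q * p) ≡⟨ cong (λ r → (r + q′ * p) ∸ (m % p + q * p)) eq ⟩
        (m % p + q′ * p) ∸ (m % p + q * p)    ≡⟨ [m+n]∸[m+o]≡n∸o (m % p) _ _ ⟩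
        q′ * p ∸ q * p                        ≡⟨ *-distribʳ-∸ p q′ q ⟨
        (q′ ∸ q) * p                          ∎
        where open ≡-Reasoning

    square-%-reflect : ∀ {x z} → z + x ≡ p → (z * z) % p ≡ (x * x) % p
    square-%-reflect {x} {z} z+x≡p = begin
      (z * z) % p                  ≡⟨ [m+kn]%n≡m%n (z * z) (x + x) p ⟨
      (z * z + (x + x) * p) % p    ≡⟨ cong (_% p) (subst (λ n → z * z + (x + x) * n ≡ x * x + n * n) z+x≡p (expand z x)) ⟩
      (x * x + p * p) % p          ≡⟨ [m+kn]%n≡m%n (x * x) p p ⟩
      (x * x) % p                  ∎
      where
      open ≡-Reasoning
      expand : ∀ z x → z * z + (x + x) * (z + x) ≡ x * x + (z + x) * (z + x)
      expand = solve-∀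

    square-%-injective-≥ : ∀ {a b} → b ≤ a → 0 < a → a ≤ h → (a * a) % p ≡ (b * b) % p → a ≡ b
    square-%-injective-≥ {a} {b} b≤a 0<a a≤h a²≡b² with euclidsLemma (a ∸ b) (b + a) p-prime p∣[a-b][b+a]
      where
      a²≡b²+[a-b][b+a] : a * a ≡ b * b + (a ∸ b) * (b + a)
      a²≡b²+[a-b][b+a] = begin
        a * a                                 ≡⟨ cong (λ x → x * x) b+[a-b]≡a ⟨
        (b + (a ∸ b)) * (b + (a ∸ b))         ≡⟨ expand b (a ∸ b) ⟩
        b * b + (a ∸ b) * (b + (b + (a ∸ b))) ≡⟨ cong (λ x → b * b + (a ∸ b) * (b + x)) b+[a-b]≡a ⟩
        b * b + (a ∸ b) * (b + a)             ∎
        where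
        open ≡-Reasoning
        b+[a-b]≡a : b + (a ∸ b) ≡ a
        b+[a-b]≡a = m+[n∸m]≡n b≤a
        expand : ∀ b d → (b + d) * (b + d) ≡ b * b + d * (b + (b + d))
        expand = solve-∀
      p∣[a-b][b+a] : p ∣ (a ∸ b) * (b + a)
      p∣[a-b][b+a] = [m+n]%p≡m%p⇒p∣n (b * b) _ (trans (cong (_% p) (sym a²≡b²+[a-b][b+a])) a²≡b²)
    ... | inj₁ p∣a-b = ≤-antisym (m∸n≡0⇒m≤n (∣∧<⇒≡0 p∣a-b (≤-<-trans (m∸n≤m a b) a<p))) b≤a
      where
      a<p : a < p
      a<p = ≤-<-trans a≤h (s≤s (m≤m+n h h))
    ... | inj₂ p∣b+a = contradiction (∣∧<⇒≡0 p∣b+a b+a<p) (>⇒≢ (<-≤-trans 0<a (m≤n+m a b)))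
      where
      b+a<p : b + a < p
      b+a<p = s≤s (+-mono-≤ (≤-trans b≤a a≤h) a≤h)

    square-%-injective : ∀ {a b} → 0 < a → a ≤ h → 0 < b → b ≤ h → (a * a) % p ≡ (b * b) % p → a ≡ b
    square-%-injective 0<a a≤h 0<b b≤h a²≡b² with ≤-total _ _
    ... | inj₁ b≤a = square-%-injective-≥ b≤a 0<a a≤h a²≡b²
    ... | inj₂ a≤b = sym (square-%-injective-≥ a≤b 0<b b≤h (sym a²≡b²))

    p∤square : ∀ {x} → 0 < x → x < p → ¬ p ∣ x * x
    p∤square {x} 0<x x<p p∣x² with euclidsLemma x x p-prime p∣x²
    ... | inj₁ p∣x = >⇒≢ 0<x (∣∧<⇒≡0 p∣x x<p)
    ... | inj₂ p∣x = >⇒≢ 0<x (∣∧<⇒≡0 p∣x x<p)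

    squares : List ℕ
    squares = applyUpTo (λ y → (suc y * suc y) % p) h

    private
      y<h⇒y+1<p : ∀ {y} → y < h → suc y < p
      y<h⇒y+1<p y<h = s≤s (≤-trans y<h (m≤m+n h h))

    χ≡1⇒∈squares : ∀ {r} → χ r ≡ + 1 → r ∈ squares
    χ≡1⇒∈squares χ≡1 with χ≡1⇒square χ≡1
    ... | r≢0 , zero , _ , 0≡r = contradiction (sym 0≡r) r≢0
    ... | _ , suc x , x+1<p , x²≡r with x <? h
    ...   | yes x<h = subst (_∈ squares) x²≡r (∈-applyUpTo⁺ _ x<h)
    ...   | no  x≮h = subst (_∈ squares) (trans (square-%-reflect {x = suc x} {z = suc z} z+x+1≡p) x²≡r) (∈-applyUpTo⁺ _ z<h)
      where
      -- the other square root (p - (x + 1)) of r is z + 1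
      z : ℕ
      z = (h + h) ∸ suc x
      z+x+1≡h+h : z + suc x ≡ h + h
      z+x+1≡h+h = m∸n+n≡m (≤-pred x+1<p)
      z+x+1≡p : suc z + suc x ≡ p
      z+x+1≡p = cong suc z+x+1≡h+h
      z<h : z < h
      z<h = +-cancelʳ-< h z h (begin-strict
        z + h        <⟨ +-monoʳ-< z (s≤s (≮⇒≥ x≮h)) ⟩
        z + suc x    ≡⟨ z+x+1≡h+h ⟩
        h + h        ∎)
        where open ≤-Reasoning

    ∈squares⇒χ≡1 : ∀ {r} → r ∈ squares → χ r ≡ + 1
    ∈squares⇒χ≡1 r∈ with ∈-applyUpTo⁻ _ r∈
    ... | y , y<h , refl = square⇒χ≡1 (λ r≡0 → p∤square (s≤s z≤n) (y<h⇒y+1<p y<h) (m%n≡0⇒n∣m _ p r≡0))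
                                       (y<h⇒y+1<p y<h) refl

    count-χ≡1 : count (λ r → χ r ℤ.≟ + 1) (upTo p) ≡ h
    count-χ≡1 = begin
      count (λ r → χ r ℤ.≟ + 1) (upTo p) ≡⟨ count-≐ (λ r → χ r ℤ.≟ + 1) (_∈? squares) (χ≡1⇒∈squares , ∈squares⇒χ≡1) (upTo p) ⟩
      count (_∈? squares) (upTo p)       ≡⟨ count-∈-upTo squares-unique squares<p ⟩
      length squares                     ≡⟨ length-applyUpTo _ h ⟩
      h                                  ∎
      where
      open ≡-Reasoning
      squares-unique : Unique squares
      squares-unique = Unique.applyUpTo⁺₁ (λ y → (suc y * suc y) % p) h (λ {i} {j} i<j j<h eq → <⇒≢ i<j
        (suc-injective (square-%-injective (s≤s z≤n) (<-trans i<j j<h) (s≤s z≤n) j<h eq)))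
      squares<p : All (_< p) squares
      squares<p = All.applyUpTo⁺₁ (λ y → (suc y * suc y) % p) h (λ {y} _ → m%n<n (suc y * suc y) p)

    count-χ≡-1 : count (λ r → χ r ℤ.≟ ℤ.- (+ 1)) (upTo p) ≡ h
    count-χ≡-1 = +-cancelˡ-≡ h _ _ (suc-injective (begin
      suc (h + count χ≡-1? (upTo p))                       ≡⟨ +-suc h _ ⟨
      h + suc (count χ≡-1? (upTo p))                       ≡⟨ cong₂ _+_ count-χ≡1 count-χ≢1 ⟨
      count χ≡1? (upTo p) + count (¬? ∘ χ≡1?) (upTo p)     ≡⟨ count-+-count-∁ χ≡1? (upTo p) ⟩
      length (upTo p)                                      ≡⟨ length-upTo p ⟩
      suc (h + h)                                          ∎))
      where
      open ≡-Reasoning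
      χ≡1? : Decidable (λ r → χ r ≡ + 1)
      χ≡1? r = χ r ℤ.≟ + 1
      χ≡-1? : Decidable (λ r → χ r ≡ ℤ.- (+ 1))
      χ≡-1? r = χ r ℤ.≟ ℤ.- (+ 1)
      χ≢1∧≢0⇒χ≡-1 : ∀ {r} → χ r ≢ + 1 × r ≢ 0 → χ r ≡ ℤ.- (+ 1)
      χ≢1∧≢0⇒χ≡-1 (χ≢1 , r≢0) with χ-nonzero r≢0
      ... | inj₁ χ≡1  = contradiction χ≡1 χ≢1
      ... | inj₂ χ≡-1 = χ≡-1
      χ≡-1⇒χ≢1∧≢0 : ∀ {r} → χ r ≡ ℤ.- (+ 1) → χ r ≢ + 1 × r ≢ 0
      χ≡-1⇒χ≢1∧≢0 χ≡-1 = (λ χ≡1 → contradiction (trans (sym χ≡-1) χ≡1) λ ()) , λ { refl → contradiction χ≡-1 λ () }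
      count-χ≢1 : count (¬? ∘ χ≡1?) (upTo p) ≡ suc (count χ≡-1? (upTo p))
      count-χ≢1 = trans (count-split (¬? ∘ χ≡1?) (_≟ 0) (upTo p)) (cong₂ _+_
        (trans (count-≐ (λ r → ¬? (χ≡1? r) ×-dec (r ≟ 0)) (_≟ 0) (proj₂ , λ { refl → (λ ()) , refl }) (upTo p))
               (count-≟-upTo {n = p} (s≤s z≤n)))
        (count-≐ (λ r → ¬? (χ≡1? r) ×-dec ¬? (r ≟ 0)) χ≡-1? (χ≢1∧≢0⇒χ≡-1 , χ≡-1⇒χ≢1∧≢0) (upTo p)))

open QuadraticResidues

module DiscriminantCounts where

  open import Data.Nat as ℕ using (ℕ; suc; _+_; _*_; _∸_; _^_; _/_; _%_; _<_; _≤_; _≟_; z≤n; s≤s)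
  open import Data.Nat.Properties
  open import Data.Nat.DivMod using (m%n<n; %-distribˡ-*)
  open import Data.Nat.Divisibility using (_∣_; _∣?_; ∣-trans; m%n≡0⇒n∣m; 1∣_)
  open import Data.Nat.Primality using (Prime; euclidsLemma)
  open import Data.Nat.Coprimality using (Coprime; coprime?)
  open import Data.Integer as ℤ using (ℤ; +_; ∣_∣; _%ℕ_)
  import Data.Integer.Properties as ℤ
  open import Data.Integer.DivMod using (n%ℕd<d)
  open import Data.Integer.Divisibility.Signed using (∣⇒∣ᵤ; ∣ᵤ⇒∣; ∣n⇒∣m*n; ∣m∣n⇒∣m+n) renaming (_∣_ to _∣ℤ_)
  open import Data.Integer.Tactic.RingSolver using (solve-∀)
  open import Data.List using (upTo)
  open import Data.Product as Product using (_×_; _,_; proj₁; proj₂)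
  open import Data.Sum using (inj₁; inj₂)
  open import Function using (Equivalence)
  open import Level using (0ℓ)
  open import Relation.Unary using (Pred; Decidable)
  open import Relation.Nullary using (¬_; contradiction)
  open import Relation.Nullary.Decidable using (_×-dec_; ¬?)
  open import Relation.Binary.PropositionalEquality
  open import Defs

  module Counts (h : ℕ) (t : ℤ) (k : ℕ)
    (p-prime : Prime (suc (h + h))) (p∤t : ¬ suc (h + h) ∣ ∣ t ∣) (1≤k : 1 ≤ k) where

    private
      p : ℕ
      p = suc (h + h)
      χ : ℕ → ℤ
      χ = residueSymbol (h + h)
      Δ : ℕ → ℤ
      Δ u = D t (+ u)
      ν : ℕ → ℕ
      ν u = νtrunc p k (Δ u)

    p^k≡p^[k-j]*p^j : ∀ {j} → j ≤ k → p ^ k ≡ p ^ (k ∸ j) * p ^ j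
    p^k≡p^[k-j]*p^j {j} j≤k = trans (cong (p ^_) (sym (m∸n+n≡m j≤k))) (^-distribˡ-+-* p (k ∸ j) j)

    count-p^j∣a-4u : ∀ {j} → j ≤ k → (a : ℤ) →
      count (λ u → p ^ j ∣? ∣ a ℤ.- + 4 ℤ.* + u ∣) (upTo (p ^ k)) ≡ p ^ (k ∸ j)
    count-p^j∣a-4u {j} j≤k a = trans
      (cong (λ n → count (λ u → p ^ j ∣? ∣ a ℤ.- + 4 ℤ.* + u ∣) (upTo n)) (p^k≡p^[k-j]*p^j j≤k))
      (count-linear-congruence (odd-^ (h , refl) j) a (p ^ (k ∸ j)))

    count-ν≡ : ∀ {n} → n < k → count (λ u → ν u ≟ n) (upTo (p ^ k)) + p ^ (k ∸ suc n) ≡ p ^ (k ∸ n)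
    count-ν≡ {n} n<k = begin
      count (λ u → ν u ≟ n) (upTo (p ^ k)) + p ^ (k ∸ suc n)
        ≡⟨ +-comm _ (p ^ (k ∸ suc n)) ⟩
      p ^ (k ∸ suc n) + count (λ u → ν u ≟ n) (upTo (p ^ k))
        ≡⟨ cong₂ _+_ exactly-n+1 exactly-n ⟨
      count (λ u → p^∣Δ? n u ×-dec p^∣Δ? (suc n) u) (upTo (p ^ k))
        + count (λ u → p^∣Δ? n u ×-dec ¬? (p^∣Δ? (suc n) u)) (upTo (p ^ k))
        ≡⟨ count-split (p^∣Δ? n) (p^∣Δ? (suc n)) (upTo (p ^ k)) ⟨
      count (p^∣Δ? n) (upTo (p ^ k))
        ≡⟨ count-p^j∣a-4u (<⇒≤ n<k) (t ℤ.* t) ⟩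
      p ^ (k ∸ n) ∎
      where
      open ≡-Reasoning
      p^∣Δ? : ∀ j → Decidable (λ u → p ^ j ∣ ∣ Δ u ∣)
      p^∣Δ? j u = p ^ j ∣? ∣ Δ u ∣
      exactly-n+1 : count (λ u → p^∣Δ? n u ×-dec p^∣Δ? (suc n) u) (upTo (p ^ k)) ≡ p ^ (k ∸ suc n)
      exactly-n+1 = trans
        (count-≐ _ (p^∣Δ? (suc n)) (proj₂ , λ p^n+1∣ → ∣-trans (^-∣-^ p (n≤1+n n)) p^n+1∣ , p^n+1∣) (upTo (p ^ k)))
        (count-p^j∣a-4u n<k (t ℤ.* t))
      exactly-n : count (λ u → p^∣Δ? n u ×-dec ¬? (p^∣Δ? (suc n) u)) (upTo (p ^ k)) ≡ count (λ u → ν u ≟ n) (upTo (p ^ k))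
      exactly-n = count-≐ _ (λ u → ν u ≟ n)
        (Equivalence.from (νtrunc≡⇔ p _ n<k) , Equivalence.to (νtrunc≡⇔ p _ n<k)) (upTo (p ^ k))

    residue : ℕ → ℕ → ℕ
    residue n u = divPow (Δ u) p n %ℕ p

    count-fibre : ∀ {n r} → n < k → r < p →
      count (λ u → (p ^ n ∣? ∣ Δ u ∣) ×-dec (residue n u ≟ r)) (upTo (p ^ k)) ≡ p ^ (k ∸ suc n)
    count-fibre {n} {r} n<k r<p =
      -- The implicit and instance arguments below are all supplied by hand: leaving them to
      -- unification makes Agda normalise D t (+ u), which exhausts memory.
      trans (count-≐ _ (λ u → p ^ suc n ∣? ∣ a ℤ.- + 4 ℤ.* + u ∣) ((λ {u} → to {u}) , (λ {u} → from {u})) (upTo (p ^ k)))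
            (count-p^j∣a-4u n<k a)
      where
      a : ℤ
      a = t ℤ.* t ℤ.- + (p ^ n) ℤ.* + r
      Δ-shift : ∀ u → Δ u ℤ.- + (p ^ n) ℤ.* + r ≡ a ℤ.- + 4 ℤ.* + u
      Δ-shift u = swap (t ℤ.* t) (+ u) (+ (p ^ n)) (+ r)
        where
        swap : ∀ T u P r → (T ℤ.- + 4 ℤ.* u) ℤ.- P ℤ.* r ≡ (T ℤ.- P ℤ.* r) ℤ.- + 4 ℤ.* u
        swap = solve-∀
      to : ∀ {u} → (p ^ n ∣ ∣ Δ u ∣) × residue n u ≡ r → p ^ suc n ∣ ∣ a ℤ.- + 4 ℤ.* + u ∣
      to {u} (p^n∣Δ , residue≡r) =
        ∣⇒∣ᵤ (subst (+ (p ^ suc n) ∣ℤ_) (Δ-shift u)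
          (∣∧quotient%≡⇒∣ {X = Δ u} {d = p ^ n} {m = p} {r = r} {{m^n≢0 p n}} {{ℕ.nonZero}} (∣ᵤ⇒∣ p^n∣Δ) residue≡r))
      from : ∀ {u} → p ^ suc n ∣ ∣ a ℤ.- + 4 ℤ.* + u ∣ → (p ^ n ∣ ∣ Δ u ∣) × residue n u ≡ r
      from {u} p^n+1∣ = Product.map₁ ∣⇒∣ᵤ (∣⇒∣∧quotient%≡ {X = Δ u} {d = p ^ n} {m = p} {r = r} {{m^n≢0 p n}} {{ℕ.nonZero}} r<p
        (subst (+ (p ^ suc n) ∣ℤ_) (sym (Δ-shift u)) (∣ᵤ⇒∣ p^n+1∣)))

    count-ν≡∧legendre≡ : ∀ {n} ε → n < k → ε ≢ + 0 →
      count (λ u → (ν u ≟ n) ×-dec (legendre (divPow (Δ u) p n) p ℤ.≟ ε)) (upTo (p ^ k))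
        ≡ p ^ (k ∸ suc n) * count (λ r → χ r ℤ.≟ ε) (upTo p)
    count-ν≡∧legendre≡ {n} ε n<k ε≢0 = trans
      (count-≐ _ (λ u → (p ^ n ∣? ∣ Δ u ∣) ×-dec (χ (residue n u) ℤ.≟ ε)) ((λ {u} → to {u}) , (λ {u} → from {u})) (upTo (p ^ k)))
      (count-fibres (λ u → p ^ n ∣? ∣ Δ u ∣) (λ r → χ r ℤ.≟ ε) (residue n) (upTo (p ^ k))
        (λ {u} _ → n%ℕd<d (divPow (Δ u) p n) p) (λ r<p → count-fibre n<k r<p))
      where
      to : ∀ {u} → ν u ≡ n × χ (residue n u) ≡ ε → (p ^ n ∣ ∣ Δ u ∣) × χ (residue n u) ≡ ε
      to {u} (ν≡n , χ≡ε) = proj₁ (Equivalence.to (νtrunc≡⇔ p (Δ u) n<k) ν≡n) , χ≡ε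
      from : ∀ {u} → (p ^ n ∣ ∣ Δ u ∣) × χ (residue n u) ≡ ε → ν u ≡ n × χ (residue n u) ≡ ε
      from {u} (p^n∣Δ , χ≡ε) = Equivalence.from (νtrunc≡⇔ p (Δ u) n<k) (p^n∣Δ , p^n+1∤Δ) , χ≡ε
        where
        -- p ^ (n + 1) ∣ Δ would make the residue 0, whose symbol is 0 ≢ ε
        p^n+1∤Δ : ¬ (p ^ suc n ∣ ∣ Δ u ∣)
        p^n+1∤Δ p^n+1∣Δ = ε≢0 (trans (sym χ≡ε) (cong χ residue≡0))
          where
          X-P*0≡X : ∀ X P → X ℤ.- P ℤ.* + 0 ≡ X
          X-P*0≡X = solve-∀
          residue≡0 : residue n u ≡ 0
          residue≡0 = proj₂ (∣⇒∣∧quotient%≡ {X = Δ u} {d = p ^ n} {m = p} {r = 0} {{m^n≢0 p n}} {{ℕ.nonZero}} (s≤s z≤n)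
            (subst (+ (p ^ suc n) ∣ℤ_) (sym (X-P*0≡X (Δ u) (+ (p ^ n)))) (∣ᵤ⇒∣ {i = Δ u} p^n+1∣Δ)))

    p∣u⇒p∣Δ-t² : ∀ {u} → p ∣ u → + p ∣ℤ Δ u ℤ.- t ℤ.* t
    p∣u⇒p∣Δ-t² {u} p∣u = subst (+ p ∣ℤ_) (Δ-t² (t ℤ.* t) (+ u)) (∣n⇒∣m*n (ℤ.- + 4) (∣ᵤ⇒∣ {i = + u} p∣u))
      where
      Δ-t² : ∀ T u → ℤ.- + 4 ℤ.* u ≡ (T ℤ.- + 4 ℤ.* u) ℤ.- T
      Δ-t² = solve-∀

    p∤t² : ¬ p ∣ ∣ t ∣ * ∣ t ∣
    p∤t² p∣t² with euclidsLemma ∣ t ∣ ∣ t ∣ p-prime p∣t²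
    ... | inj₁ p∣t = p∤t p∣t
    ... | inj₂ p∣t = p∤t p∣t

    p∣u⇒ν≡0 : ∀ {u} → p ∣ u → ν u ≡ 0
    p∣u⇒ν≡0 {u} p∣u = Equivalence.from (νtrunc≡⇔ p (Δ u) 1≤k) (1∣ _ , p∤Δ)
      where
      p∤Δ : ¬ (p ^ 1 ∣ ∣ Δ u ∣)
      p∤Δ p^1∣Δ = p∤t² (subst (p ∣_) (cong ∣_∣ (i*i≡+∣i∣² t)) (∣⇒∣ᵤ (subst (+ p ∣ℤ_) (sym t²≡Δ+4u)
        (∣m∣n⇒∣m+n (∣ᵤ⇒∣ {i = Δ u} (subst (_∣ ∣ Δ u ∣) (*-identityʳ p) p^1∣Δ)) (∣n⇒∣m*n (+ 4) (∣ᵤ⇒∣ {i = + u} p∣u))))))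
        where
        t²≡Δ+4u : t ℤ.* t ≡ Δ u ℤ.+ + 4 ℤ.* + u
        t²≡Δ+4u = expand (t ℤ.* t) (+ u)
          where
          expand : ∀ T u → T ≡ (T ℤ.- + 4 ℤ.* u) ℤ.+ + 4 ℤ.* u
          expand = solve-∀

    p∣u⇒legendre≡1 : ∀ {u} → p ∣ u → legendre (divPow (Δ u) p 0) p ≡ + 1
    p∣u⇒legendre≡1 {u} p∣u = trans (cong χ residue≡t²) (square⇒χ≡1 h p-prime t²≢0 (m%n<n ∣ t ∣ p) (sym (%-distribˡ-* ∣ t ∣ ∣ t ∣ p)))
      where
      t²≢0 : (∣ t ∣ * ∣ t ∣) % p ≢ 0
      t²≢0 t²≡0 = p∤t² (m%n≡0⇒n∣m _ p t²≡0)
      residue≡t² : divPow (Δ u) p 0 %ℕ p ≡ (∣ t ∣ * ∣ t ∣) % p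
      residue≡t² = begin
        (Δ u ℤ./ℕ 1) %ℕ p            ≡⟨ cong (λ X → (X ℤ./ℕ 1) %ℕ p) (ℤ.*-identityʳ (Δ u)) ⟨
        ((Δ u ℤ.* + 1) ℤ./ℕ 1) %ℕ p  ≡⟨ cong (_%ℕ p) (*-/ℕ-cancel (Δ u) 1) ⟩
        Δ u %ℕ p                     ≡⟨ %ℕ-cong {X = Δ u} {Y = t ℤ.* t} (p∣u⇒p∣Δ-t² p∣u) ⟩
        (t ℤ.* t) %ℕ p               ≡⟨ cong (_%ℕ p) (i*i≡+∣i∣² t) ⟩
        (∣ t ∣ * ∣ t ∣) % p          ∎
        where open ≡-Reasoning

    count-units : {P : Pred ℕ 0ℓ} (P? : Decidable P) → (∀ {u} → p ∣ u → ¬ P u) →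
      count (λ u → coprime? u (p ^ k) ×-dec P? u) (upTo (p ^ k)) ≡ count P? (upTo (p ^ k))
    count-units P? p∣⇒¬P = count-≐ (λ u → coprime? u (p ^ k) ×-dec P? u) P?
      (proj₂ , λ Pu → ∤⇒coprime-^ p-prime k (λ p∣u → p∣⇒¬P p∣u Pu) , Pu) (upTo (p ^ k))

    φ-^/2-shifted : ∀ {n} → n < k → φ (p ^ (k ∸ n)) / 2 ≡ p ^ (k ∸ suc n) * h
    φ-^/2-shifted {n} n<k = trans (cong (λ e → φ (p ^ e) / 2) (+-∸-assoc 1 n<k)) (φ-^/2 h p-prime (k ∸ suc n))

    count-units-ν≡∧legendre≡-1 : ∀ {n} → n < k →
      count (λ u → coprime? u (p ^ k) ×-dec (ν u ≟ n) ×-dec (legendre (divPow (Δ u) p n) p ℤ.≟ ℤ.- (+ 1))) (upTo (p ^ k))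
        ≡ φ (p ^ (k ∸ n)) / 2
    count-units-ν≡∧legendre≡-1 {n} n<k = begin
      _                                                            ≡⟨ count-units _ p∣⇒¬P ⟩
      count (λ u → (ν u ≟ n) ×-dec (legendre (divPow (Δ u) p n) p ℤ.≟ ℤ.- (+ 1))) (upTo (p ^ k))
                                                                   ≡⟨ count-ν≡∧legendre≡ (ℤ.- (+ 1)) n<k (λ ()) ⟩
      p ^ (k ∸ suc n) * count (λ r → χ r ℤ.≟ ℤ.- (+ 1)) (upTo p)   ≡⟨ cong (p ^ (k ∸ suc n) *_) (count-χ≡-1 h p-prime) ⟩
      p ^ (k ∸ suc n) * h                                          ≡⟨ φ-^/2-shifted n<k ⟨
      φ (p ^ (k ∸ n)) / 2                                          ∎
      where
      open ≡-Reasoning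
      p∣⇒¬P : ∀ {u} → p ∣ u → ¬ (ν u ≡ n × legendre (divPow (Δ u) p n) p ≡ ℤ.- (+ 1))
      p∣⇒¬P {u} p∣u (ν≡n , legendre≡-1) with trans (sym ν≡n) (p∣u⇒ν≡0 p∣u)
      ... | refl = contradiction (trans (sym legendre≡-1) (p∣u⇒legendre≡1 p∣u)) λ ()

    count-units-ν≡∧legendre≡1 : ∀ {n} → 0 < n → n < k →
      count (λ u → coprime? u (p ^ k) ×-dec (ν u ≟ n) ×-dec (legendre (divPow (Δ u) p n) p ℤ.≟ + 1)) (upTo (p ^ k))
        ≡ φ (p ^ (k ∸ n)) / 2
    count-units-ν≡∧legendre≡1 {n} 0<n n<k = begin
      _
        ≡⟨ count-units _ (λ p∣u (ν≡n , _) → >⇒≢ 0<n (trans (sym ν≡n) (p∣u⇒ν≡0 p∣u))) ⟩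
      count (λ u → (ν u ≟ n) ×-dec (legendre (divPow (Δ u) p n) p ℤ.≟ + 1)) (upTo (p ^ k))
                                                              ≡⟨ count-ν≡∧legendre≡ (+ 1) n<k (λ ()) ⟩
      p ^ (k ∸ suc n) * count (λ r → χ r ℤ.≟ + 1) (upTo p)
        ≡⟨ cong (p ^ (k ∸ suc n) *_) (count-χ≡1 h p-prime) ⟩
      p ^ (k ∸ suc n) * h
        ≡⟨ φ-^/2-shifted n<k ⟨
      φ (p ^ (k ∸ n)) / 2 ∎
      where open ≡-Reasoning

    count-units-ν≡ : ∀ {n} → 0 < n → n < k → count (λ u → coprime? u (p ^ k) ×-dec (ν u ≟ n)) (upTo (p ^ k)) ≡ φ (p ^ (k ∸ n))
    count-units-ν≡ {n} 0<n n<k = trans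
      (count-units _ (λ p∣u ν≡n → >⇒≢ 0<n (trans (sym ν≡n) (p∣u⇒ν≡0 p∣u))))
      (+-cancelʳ-≡ (p ^ (k ∸ suc n)) _ _ (trans (count-ν≡ n<k) (sym φ-^-shifted)))
      where
      φ-^-shifted : φ (p ^ (k ∸ n)) + p ^ (k ∸ suc n) ≡ p ^ (k ∸ n)
      φ-^-shifted = subst (λ e → φ (p ^ e) + p ^ (k ∸ suc n) ≡ p ^ e) (sym (+-∸-assoc 1 n<k)) (φ-^ p-prime (k ∸ suc n))

    count-units-ν≡k : count (λ u → coprime? u (p ^ k) ×-dec (ν u ≟ k)) (upTo (p ^ k)) ≡ 1
    count-units-ν≡k = begin
      _
        ≡⟨ count-units _ (λ p∣u ν≡k → >⇒≢ 1≤k (trans (sym ν≡k) (p∣u⇒ν≡0 p∣u))) ⟩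
      count (λ u → ν u ≟ k) (upTo (p ^ k))
        ≡⟨ count-≐ _ (λ u → p ^ k ∣? ∣ Δ u ∣)
             (Equivalence.to (νtrunc≡k⇔ p k _) , Equivalence.from (νtrunc≡k⇔ p k _)) (upTo (p ^ k)) ⟩
      count (λ u → p ^ k ∣? ∣ Δ u ∣) (upTo (p ^ k))
        ≡⟨ count-p^j∣a-4u ≤-refl (t ℤ.* t) ⟩
      p ^ (k ∸ k)
        ≡⟨ cong (p ^_) (n∸n≡0 k) ⟩
      1 ∎
      where open ≡-Reasoning

    count-units-ν≡0∧legendre≡1 :
      count (λ u → coprime? u (p ^ k) ×-dec (ν u ≟ 0) ×-dec (legendre (divPow (Δ u) p 0) p ℤ.≟ + 1)) (upTo (p ^ k)) + p ^ (k ∸ 1)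
        ≡ φ (p ^ k) / 2
    count-units-ν≡0∧legendre≡1 = begin
      count units∧Q? (upTo (p ^ k)) + p ^ (k ∸ 1)                 ≡⟨ +-comm _ (p ^ (k ∸ 1)) ⟩
      p ^ (k ∸ 1) + count units∧Q? (upTo (p ^ k))                 ≡⟨ cong₂ _+_ multiples-part units-part ⟨
      count (λ u → Q? u ×-dec (p ∣? u)) (upTo (p ^ k)) + count (λ u → Q? u ×-dec ¬? (p ∣? u)) (upTo (p ^ k))
                                                                  ≡⟨ count-split Q? (p ∣?_) (upTo (p ^ k)) ⟨
      count Q? (upTo (p ^ k))                                     ≡⟨ count-ν≡∧legendre≡ (+ 1) 1≤k (λ ()) ⟩
      p ^ (k ∸ 1) * count (λ r → χ r ℤ.≟ + 1) (upTo p)            ≡⟨ cong (p ^ (k ∸ 1) *_) (count-χ≡1 h p-prime) ⟩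
      p ^ (k ∸ 1) * h                                             ≡⟨ φ-^/2-shifted 1≤k ⟨
      φ (p ^ k) / 2                                               ∎
      where
      open ≡-Reasoning
      Q? : Decidable (λ u → ν u ≡ 0 × legendre (divPow (Δ u) p 0) p ≡ + 1)
      Q? u = (ν u ≟ 0) ×-dec (legendre (divPow (Δ u) p 0) p ℤ.≟ + 1)
      units∧Q? : Decidable (λ u → Coprime u (p ^ k) × ν u ≡ 0 × legendre (divPow (Δ u) p 0) p ≡ + 1)
      units∧Q? u = coprime? u (p ^ k) ×-dec Q? u
      multiples-part : count (λ u → Q? u ×-dec (p ∣? u)) (upTo (p ^ k)) ≡ p ^ (k ∸ 1)
      multiples-part = begin
        count (λ u → Q? u ×-dec (p ∣? u)) (upTo (p ^ k))
          ≡⟨ count-≐ _ (p ∣?_) (proj₂ , λ p∣u → (p∣u⇒ν≡0 p∣u , p∣u⇒legendre≡1 p∣u) , p∣u) (upTo (p ^ k)) ⟩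
        count (p ∣?_) (upTo (p ^ k))
          ≡⟨ cong (λ n → count (p ∣?_) (upTo n)) (trans (p^k≡p^[k-j]*p^j 1≤k) (cong (p ^ (k ∸ 1) *_) (*-identityʳ p))) ⟩
        count (p ∣?_) (upTo (p ^ (k ∸ 1) * p))
          ≡⟨ count-multiples p-prime (p ^ (k ∸ 1)) ⟩
        p ^ (k ∸ 1) ∎
      units-part : count (λ u → Q? u ×-dec ¬? (p ∣? u)) (upTo (p ^ k)) ≡ count units∧Q? (upTo (p ^ k))
      units-part = count-≐ _ units∧Q?
        ((λ (q , p∤u) → ∤⇒coprime-^ p-prime k p∤u , q) , (λ (u⊥p^k , q) → q , coprime-^⇒∤ p-prime 1≤k u⊥p^k)) (upTo (p ^ k))

open DiscriminantCounts

open import Defs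
open import Data.Nat using (ℕ; _^_; _*_; _+_; _<_; _≤_; _∸_; _/_; _≟_)
open import Data.Nat.Primality using (Prime)
open import Data.Nat.Coprimality using (Coprime; coprime?)
open import Data.Integer as ℤ using (ℤ; +_; ∣_∣)
open import Data.List using (filter; length; upTo)
open import Data.Product using (_×_)
open import Relation.Nullary.Decidable using (_×-dec_)
open import Relation.Binary.PropositionalEquality using (_≡_)

open import Data.Nat using (zero; suc; s≤s; z≤n; nonTrivial⇒≢1)
open import Data.Nat.Properties using (m≤n+m)
open import Data.Nat.Divisibility using (_∣_; ∣-refl; ∣-trans; n∣m*n; m∣m*n)
open import Data.Nat.Primality using (prime⇒nonTrivial)
import Data.Integer.Properties as ℤ
open import Data.Integer.Tactic.RingSolver using (solve-∀)
open import Data.Product using (_,_)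
open import Relation.Nullary using (¬_; contradiction)
open import Relation.Binary.PropositionalEquality using (refl; sym; trans; cong; subst)

module _ {ℓ : ℕ} {t : ℤ} (ℓ-prime : Prime ℓ) (ℓ⊥2t : Coprime ℓ ∣ + 2 ℤ.* t ∣) where

  private
    ∣2t∣≡2∣t∣ : ∣ + 2 ℤ.* t ∣ ≡ 2 * ∣ t ∣
    ∣2t∣≡2∣t∣ = ℤ.abs-* (+ 2) t

  prime⊥2t⇒odd : Odd ℓ
  prime⊥2t⇒odd = ∤2⇒odd λ 2∣ℓ → contradiction (ℓ⊥2t (2∣ℓ , subst (2 ∣_) (sym ∣2t∣≡2∣t∣) (m∣m*n ∣ t ∣))) λ ()

  prime⊥2t⇒∤t : ¬ ℓ ∣ ∣ t ∣
  prime⊥2t⇒∤t ℓ∣t =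
    nonTrivial⇒≢1 {{prime⇒nonTrivial ℓ-prime}} (ℓ⊥2t (∣-refl , subst (ℓ ∣_) (sym ∣2t∣≡2∣t∣) (∣-trans ℓ∣t (n∣m*n 2))))

m+n≡o⇒+m≡+o-+n*1 : ∀ {m n o} → m + n ≡ o → + m ≡ + o ℤ.- + n ℤ.* + 1
m+n≡o⇒+m≡+o-+n*1 {m} {n} refl = trans (cancel (+ m) (+ n)) (cong (λ z → z ℤ.- + n ℤ.* + 1) (sym (ℤ.pos-+ m n)))
  where
  cancel : ∀ m n → m ≡ (m ℤ.+ n) ℤ.- n ℤ.* + 1
  cancel = solve-∀

m≡o⇒+m≡+o-+n*0 : ∀ {m o} n → m ≡ o → + m ≡ + o ℤ.- + n ℤ.* + 0
m≡o⇒+m≡+o-+n*0 {m} n refl = cancel (+ m) (+ n)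
  where
  cancel : ∀ m n → m ≡ m ℤ.- n ℤ.* + 0
  cancel = solve-∀

lemma4p2 : (ℓ : ℕ) (t : ℤ) (k : ℕ) → Prime ℓ → Coprime ℓ ∣ (+ 2) ℤ.* t ∣ → 1 ≤ k →
    ((i : ℕ) → 2 * i < k →
      + length (filter (λ u → coprime? u (ℓ ^ k) ×-dec (νtrunc ℓ k (D t (+ u)) ≟ 2 * i)
                              ×-dec (legendre (divPow (D t (+ u)) ℓ (2 * i)) ℓ ℤ.≟ + 1))
                       (upTo (ℓ ^ k)))
      ≡ + (φ (ℓ ^ (k ∸ 2 * i)) / 2) ℤ.- (+ (ℓ ^ (k ∸ 1)) ℤ.* (if0 i)))
    × ((i : ℕ) → 2 * i < k →
      length (filter (λ u → coprime? u (ℓ ^ k) ×-dec (νtrunc ℓ k (D t (+ u)) ≟ 2 * i)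
                            ×-dec (legendre (divPow (D t (+ u)) ℓ (2 * i)) ℓ ℤ.≟ ℤ.- (+ 1)))
                     (upTo (ℓ ^ k)))
      ≡ φ (ℓ ^ (k ∸ 2 * i)) / 2)
    × ((i : ℕ) → 2 * i + 1 < k →
      length (filter (λ u → coprime? u (ℓ ^ k) ×-dec (νtrunc ℓ k (D t (+ u)) ≟ 2 * i + 1))
                     (upTo (ℓ ^ k)))
      ≡ φ (ℓ ^ (k ∸ (2 * i + 1))))
    × (length (filter (λ u → coprime? u (ℓ ^ k) ×-dec (νtrunc ℓ k (D t (+ u)) ≟ k))
                      (upTo (ℓ ^ k)))
      ≡ 1)
lemma4p2 ℓ t k ℓ-prime ℓ⊥2t 1≤k with prime⊥2t⇒odd {t = t} ℓ-prime ℓ⊥2t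
... | h , refl =
    (λ { zero    _    → m+n≡o⇒+m≡+o-+n*1 count-units-ν≡0∧legendre≡1
       ; (suc i) 2i<k → m≡o⇒+m≡+o-+n*0 (suc (h + h) ^ (k ∸ 1)) (count-units-ν≡∧legendre≡1 (s≤s z≤n) 2i<k) })
  , (λ _ 2i<k → count-units-ν≡∧legendre≡-1 2i<k)
  , (λ i 2i+1<k → count-units-ν≡ (m≤n+m 1 (2 * i)) 2i+1<k)
  , count-units-ν≡k
  where open Counts h t k ℓ-prime (prime⊥2t⇒∤t {t = t} ℓ-prime ℓ⊥2t) 1≤k
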